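{- For all nonnegative integers $n,k,m$, \[ w_{n,k,m}=\begin{cases}\dfrac{1}{k}\dbinom{n}{k-1}\dbinom{n-k-1}{m-1}\dbinom{k}{m}, & \text{if } m>0,\ m\le k,\ \text{and } k+m\le n,\\[2mm] 1, & \text{if } m=0 \text{ and } n=k,\\ 0, & \text{otherwise.}\end{cases} \]
   Context: A Dyck path of semilength $n$ is a word in the letters $U,D$ with $n$ copies of each letter such that no prefix contains more $D$'s than $U$'s. A $UD$-factor (resp. $UUD$-factor) is an occurrence of $UD$ (resp. $UUD$) as a consecutive subword. $w_{n,k,m}$ denotes the number of Dyck paths of semilength $n$ with exactly $k$ $UD$-factors and exactly $m$ $UUD$-factors. -}

module Defs where

open import Data.Nat using (ℕ; zero; suc; _+_; _*_; _∸_; _≤_; _<_)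
open import Data.Nat.Combinatorics using (_C_)
open import Data.List using (List; []; _∷_; length; filter; map; concatMap; _++_)
open import Data.Bool using (Bool; true; false; _∧_)
open import Data.Nat using (_≡ᵇ_)
open import Relation.Binary.PropositionalEquality using (_≡_)
open import Relation.Nullary.Decidable using (Dec; yes; no)
open import Data.Bool.Properties using () renaming (_≟_ to _≟B_)

data Step : Set where
  U D : Step

words : ℕ → List (List Step)
words zero    = [] ∷ []
words (suc ℓ) = concatMap (λ w → (U ∷ w) ∷ (D ∷ w) ∷ []) (words ℓ)

#U : List Step → ℕ
#U []      = 0
#U (U ∷ w) = suc (#U w)
#U (D ∷ w) = #U w

#D : List Step → ℕ
#D []      = 0
#D (U ∷ w) = #D w
#D (D ∷ w) = suc (#D w)

prefixOK : ℕ → List Step → Bool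
prefixOK h       []      = true
prefixOK h       (U ∷ w) = prefixOK (suc h) w
prefixOK zero    (D ∷ w) = false
prefixOK (suc h) (D ∷ w) = prefixOK h w

isDyck : ℕ → List Step → Bool
isDyck n w = (#U w ≡ᵇ n) ∧ (#D w ≡ᵇ n) ∧ prefixOK 0 w

#UD : List Step → ℕ
#UD (U ∷ D ∷ w) = suc (#UD (D ∷ w))
#UD (x ∷ w)     = #UD w
#UD []          = 0

#UUD : List Step → ℕ
#UUD (U ∷ U ∷ D ∷ w) = suc (#UUD (U ∷ D ∷ w))
#UUD (x ∷ w)         = #UUD w
#UUD []              = 0

w : ℕ → ℕ → ℕ → ℕ
w n k m = length (filter (λ p → (isDyck n p ∧ (#UD p ≡ᵇ k) ∧ (#UUD p ≡ᵇ m)) ≟B true) (words (n + n)))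

-- Appending D to a Dyck path of semilength n gives a word with n U's and n + 1 D's that first
-- reaches height −1 at its last step, and the appended D creates no UD- or UUD-factor. By the
-- cycle lemma every word with n U's and n + 1 D's has exactly one rotation of this kind, while
-- n + 1 of its rotations start with D. Counting factors cyclically, so that they are invariant
-- under rotation, double counting gives (n + 1) w(n,k,m) = #{p : p has n U's and n D's, and
-- p D has k UD- and m UUD-factors}. These words are counted by their runs: the k U-runs each
-- end in a UD-factor, m of them (chosen in C(k,m) ways) have length ≥ 2, their surplus U's
-- form a composition counted by C(n−k−1, m−1), and the n + 1 D's are placed in C(n+1, k) ways.
-- Finally k C(n+1, k) = (n + 1) C(n, k−1).

module Submission where

open import Defs
open import Data.Bool using (Bool; true; false; _∧_)
open import Data.Bool.Properties using (∧-comm; ∧-identityʳ; ∧-zeroʳ; T-∧; T-≡) renaming (_≟_ to _≟B_)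
open import Data.Empty using (⊥-elim)
open import Data.List using (List; []; _∷_; _++_; _∷ʳ_; initLast; _∷ʳ′_; length; filter; map; concatMap; replicate; take)
open import Data.List.Properties using (++-assoc; ++-identityʳ; length-++; ∷ʳ-++)
open import Data.Nat.ListAction using (sum)
open import Data.Nat using (ℕ; zero; suc; _+_; _*_; _∸_; _≤_; _<_; _≡ᵇ_; z≤n; s≤s; _≤?_)
open import Data.Nat.Properties
open import Data.Nat.Combinatorics using (_C_; nCk+nC[k+1]≡[n+1]C[k+1]; k>n⇒nCk≡0; nCk≡nC[n∸k]; nC1≡n)
open import Data.Nat.Tactic.RingSolver using (solve-∀)
open import Data.Product using (_×_; _,_; proj₁; proj₂; ∃₂)
open import Data.Sum using (_⊎_; inj₁; inj₂)
open import Function using (_∘_; Equivalence)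
open import Relation.Binary.PropositionalEquality
open import Relation.Nullary using (¬_; yes; no)

⟦_⟧ : Bool → ℕ
⟦ true ⟧  = 1
⟦ false ⟧ = 0

length-filter≡sum : ∀ {A : Set} (P : A → Bool) (xs : List A) →
  length (filter (λ x → P x ≟B true) xs) ≡ sum (map (⟦_⟧ ∘ P) xs)
length-filter≡sum P []       = refl
length-filter≡sum P (x ∷ xs) with P x
... | true  = cong suc (length-filter≡sum P xs)
... | false = length-filter≡sum P xs

Σ-words : ℕ → (List Step → ℕ) → ℕ
Σ-words zero    f = f []
Σ-words (suc ℓ) f = Σ-words ℓ (f ∘ (U ∷_)) + Σ-words ℓ (f ∘ (D ∷_))

sum-map-words : ∀ ℓ f → sum (map f (words ℓ)) ≡ Σ-words ℓ f
sum-map-words zero    f = +-identityʳ (f [])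
sum-map-words (suc ℓ) f = trans (sum-map-extend f (words ℓ))
  (cong₂ _+_ (sum-map-words ℓ (f ∘ (U ∷_))) (sum-map-words ℓ (f ∘ (D ∷_))))
  where
  sum-map-extend : ∀ f xs →
    sum (map f (concatMap (λ w → (U ∷ w) ∷ (D ∷ w) ∷ []) xs))
      ≡ sum (map (f ∘ (U ∷_)) xs) + sum (map (f ∘ (D ∷_)) xs)
  sum-map-extend f []       = refl
  sum-map-extend f (x ∷ xs) =
    trans (cong (λ r → f (U ∷ x) + (f (D ∷ x) + r)) (sum-map-extend f xs))
          (shuffle (f (U ∷ x)) (f (D ∷ x)) (sum (map (f ∘ (U ∷_)) xs)) (sum (map (f ∘ (D ∷_)) xs)))
    where
    shuffle : ∀ a b c d → a + (b + (c + d)) ≡ (a + c) + (b + d)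
    shuffle = solve-∀

x*[y*z]≡y*[x*z] : ∀ x y z → x * (y * z) ≡ y * (x * z)
x*[y*z]≡y*[x*z] = solve-∀

[a+b]+[c+d]≡[a+c]+[b+d] : ∀ a b c d → (a + b) + (c + d) ≡ (a + c) + (b + d)
[a+b]+[c+d]≡[a+c]+[b+d] = solve-∀

Σ-words-cong : ∀ ℓ {f g : List Step → ℕ} → (∀ w → length w ≡ ℓ → f w ≡ g w) →
  Σ-words ℓ f ≡ Σ-words ℓ g
Σ-words-cong zero    f≗g = f≗g [] refl
Σ-words-cong (suc ℓ) f≗g = cong₂ _+_
  (Σ-words-cong ℓ (λ w e → f≗g (U ∷ w) (cong suc e)))
  (Σ-words-cong ℓ (λ w e → f≗g (D ∷ w) (cong suc e)))

Σ-words-0 : ∀ ℓ → Σ-words ℓ (λ _ → 0) ≡ 0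
Σ-words-0 zero    = refl
Σ-words-0 (suc ℓ) = cong₂ _+_ (Σ-words-0 ℓ) (Σ-words-0 ℓ)

Σ-words-+ : ∀ ℓ f g → Σ-words ℓ (λ w → f w + g w) ≡ Σ-words ℓ f + Σ-words ℓ g
Σ-words-+ zero    f g = refl
Σ-words-+ (suc ℓ) f g =
  trans (cong₂ _+_ (Σ-words-+ ℓ (f ∘ (U ∷_)) (g ∘ (U ∷_))) (Σ-words-+ ℓ (f ∘ (D ∷_)) (g ∘ (D ∷_))))
        ([a+b]+[c+d]≡[a+c]+[b+d] (Σ-words ℓ (f ∘ (U ∷_))) (Σ-words ℓ (g ∘ (U ∷_)))
                                 (Σ-words ℓ (f ∘ (D ∷_))) (Σ-words ℓ (g ∘ (D ∷_))))

Σ-words-*ˡ : ∀ ℓ c f → Σ-words ℓ (λ w → c * f w) ≡ c * Σ-words ℓ f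
Σ-words-*ˡ zero    c f = refl
Σ-words-*ˡ (suc ℓ) c f =
  trans (cong₂ _+_ (Σ-words-*ˡ ℓ c (f ∘ (U ∷_))) (Σ-words-*ˡ ℓ c (f ∘ (D ∷_))))
        (sym (*-distribˡ-+ c _ _))

Σ-words-∷ʳ : ∀ ℓ f → Σ-words (suc ℓ) f ≡ Σ-words ℓ (f ∘ (_∷ʳ U)) + Σ-words ℓ (f ∘ (_∷ʳ D))
Σ-words-∷ʳ zero    f = refl
Σ-words-∷ʳ (suc ℓ) f =
  trans (cong₂ _+_ (Σ-words-∷ʳ ℓ (f ∘ (U ∷_))) (Σ-words-∷ʳ ℓ (f ∘ (D ∷_))))
        ([a+b]+[c+d]≡[a+c]+[b+d] (Σ-words ℓ (λ w → f (U ∷ w ∷ʳ U))) (Σ-words ℓ (λ w → f (U ∷ w ∷ʳ D)))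
                                 (Σ-words ℓ (λ w → f (D ∷ w ∷ʳ U))) (Σ-words ℓ (λ w → f (D ∷ w ∷ʳ D))))

-- Rotations and cyclic sums

rotate : List Step → List Step
rotate []       = []
rotate (x ∷ xs) = xs ∷ʳ x

rotate^ : ℕ → List Step → List Step
rotate^ zero    v = v
rotate^ (suc r) v = rotate^ r (rotate v)

Σ-words-rotate : ∀ ℓ f → Σ-words ℓ (f ∘ rotate) ≡ Σ-words ℓ f
Σ-words-rotate zero    f = refl
Σ-words-rotate (suc ℓ) f = sym (Σ-words-∷ʳ ℓ f)

cyclicSum : ℕ → (List Step → ℕ) → List Step → ℕ
cyclicSum zero    g v = 0
cyclicSum (suc L) g v = g v + cyclicSum L g (rotate v)

Σ-words-cyclicSum : ∀ ℓ L g → Σ-words ℓ (cyclicSum L g) ≡ L * Σ-words ℓ g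
Σ-words-cyclicSum ℓ zero    g = Σ-words-0 ℓ
Σ-words-cyclicSum ℓ (suc L) g = trans (Σ-words-+ ℓ g (cyclicSum L g ∘ rotate))
  (cong (Σ-words ℓ g +_) (trans (Σ-words-rotate ℓ (cyclicSum L g)) (Σ-words-cyclicSum ℓ L g)))

cyclicSum-*ˡ : ∀ (c : List Step → ℕ) → (∀ v → c (rotate v) ≡ c v) →
  ∀ L g v → cyclicSum L (λ u → c u * g u) v ≡ c v * cyclicSum L g v
cyclicSum-*ˡ c c-rotate zero    g v = sym (*-zeroʳ (c v))
cyclicSum-*ˡ c c-rotate (suc L) g v = begin
  c v * g v + cyclicSum L (λ u → c u * g u) (rotate v) ≡⟨ cong (c v * g v +_) (cyclicSum-*ˡ c c-rotate L g (rotate v)) ⟩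
  c v * g v + c (rotate v) * cyclicSum L g (rotate v) ≡⟨ cong (λ x → c v * g v + x * cyclicSum L g (rotate v)) (c-rotate v) ⟩
  c v * g v + c v * cyclicSum L g (rotate v)          ≡⟨ *-distribˡ-+ (c v) _ _ ⟨
  c v * (g v + cyclicSum L g (rotate v))              ∎
  where open ≡-Reasoning

length-rotate : ∀ v → length (rotate v) ≡ length v
length-rotate []       = refl
length-rotate (x ∷ xs) = trans (length-++ xs) (+-comm (length xs) 1)

rotate^-++ : ∀ x y → rotate^ (length x) (x ++ y) ≡ y ++ x
rotate^-++ []      y = sym (++-identityʳ y)
rotate^-++ (a ∷ x) y = begin
  rotate^ (length x) ((x ++ y) ∷ʳ a) ≡⟨ cong (rotate^ (length x)) (++-assoc x y (a ∷ [])) ⟩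
  rotate^ (length x) (x ++ y ∷ʳ a)   ≡⟨ rotate^-++ x (y ∷ʳ a) ⟩
  (y ∷ʳ a) ++ x                      ≡⟨ ∷ʳ-++ y a x ⟩
  y ++ a ∷ x                         ∎
  where open ≡-Reasoning

rotate^-length : ∀ v → rotate^ (length v) v ≡ v
rotate^-length v = begin
  rotate^ (length v) v        ≡⟨ cong (rotate^ (length v)) (++-identityʳ v) ⟨
  rotate^ (length v) (v ++ []) ≡⟨ rotate^-++ v [] ⟩
  v                           ∎
  where open ≡-Reasoning

cyclicSum-∷ʳ : ∀ L g v → cyclicSum (suc L) g v ≡ cyclicSum L g v + g (rotate^ L v)
cyclicSum-∷ʳ zero    g v = +-identityʳ (g v)
cyclicSum-∷ʳ (suc L) g v =
  trans (cong (g v +_) (cyclicSum-∷ʳ L g (rotate v))) (sym (+-assoc (g v) _ _))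

cyclicSum-rotate : ∀ g v → cyclicSum (length v) g (rotate v) ≡ cyclicSum (length v) g v
cyclicSum-rotate g []      = refl
cyclicSum-rotate g (a ∷ v) = +-cancelʳ-≡ (g (a ∷ v)) _ _ (begin
  cyclicSum L g (rotate (a ∷ v)) + g (a ∷ v)   ≡⟨ +-comm _ (g (a ∷ v)) ⟩
  cyclicSum (suc L) g (a ∷ v)                  ≡⟨ cyclicSum-∷ʳ L g (a ∷ v) ⟩
  cyclicSum L g (a ∷ v) + g (rotate^ L (a ∷ v)) ≡⟨ cong (λ u → cyclicSum L g (a ∷ v) + g u) (rotate^-length (a ∷ v)) ⟩
  cyclicSum L g (a ∷ v) + g (a ∷ v)            ∎)
  where
  open ≡-Reasoning
  L = length (a ∷ v)

#U-++ : ∀ xs ys → #U (xs ++ ys) ≡ #U xs + #U ys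
#U-++ []       ys = refl
#U-++ (U ∷ xs) ys = cong suc (#U-++ xs ys)
#U-++ (D ∷ xs) ys = #U-++ xs ys

#D-++ : ∀ xs ys → #D (xs ++ ys) ≡ #D xs + #D ys
#D-++ []       ys = refl
#D-++ (U ∷ xs) ys = #D-++ xs ys
#D-++ (D ∷ xs) ys = cong suc (#D-++ xs ys)

#U-rotate : ∀ v → #U (rotate v) ≡ #U v
#U-rotate []      = refl
#U-rotate (U ∷ v) = trans (#U-++ v (U ∷ [])) (+-comm (#U v) 1)
#U-rotate (D ∷ v) = trans (#U-++ v (D ∷ [])) (+-identityʳ (#U v))

#D-rotate : ∀ v → #D (rotate v) ≡ #D v
#D-rotate []      = refl
#D-rotate (U ∷ v) = trans (#D-++ v (U ∷ [])) (+-identityʳ (#D v))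
#D-rotate (D ∷ v) = trans (#D-++ v (D ∷ [])) (+-comm (#D v) 1)

rotate^-invariant : (f : List Step → ℕ) → (∀ v → f (rotate v) ≡ f v) → ∀ r v → f (rotate^ r v) ≡ f v
rotate^-invariant f f-rotate zero    v = refl
rotate^-invariant f f-rotate (suc r) v = trans (rotate^-invariant f f-rotate r (rotate v)) (f-rotate v)

-- First passages and the cycle lemma

-- A path from height h whose first visit to height −1 is its last step.
isFirstPassage : ℕ → List Step → Bool
isFirstPassage h       []          = false
isFirstPassage h       (U ∷ v)     = isFirstPassage (suc h) v
isFirstPassage zero    (D ∷ [])    = true
isFirstPassage zero    (D ∷ _ ∷ _) = false
isFirstPassage (suc h) (D ∷ v)     = isFirstPassage h v

firstPassage : List Step → ℕ
firstPassage v = ⟦ isFirstPassage 0 v ⟧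

firstPassageRotations : List Step → ℕ
firstPassageRotations v = cyclicSum (length v) firstPassage v

firstPassageRotations-rotate : ∀ v → firstPassageRotations (rotate v) ≡ firstPassageRotations v
firstPassageRotations-rotate v =
  trans (cong (λ L → cyclicSum L firstPassage (rotate v)) (length-rotate v)) (cyclicSum-rotate firstPassage v)

isFirstPassage-removeUD : ∀ h p c q → isFirstPassage h (p ++ U ∷ D ∷ c ∷ q) ≡ isFirstPassage h (p ++ c ∷ q)
isFirstPassage-removeUD h       []          c q = refl
isFirstPassage-removeUD h       (U ∷ p)     c q = isFirstPassage-removeUD (suc h) p c q
isFirstPassage-removeUD zero    (D ∷ [])    c q = refl
isFirstPassage-removeUD zero    (D ∷ _ ∷ p) c q = refl
isFirstPassage-removeUD (suc h) (D ∷ p)     c q = isFirstPassage-removeUD h p c q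

isFirstPassage-++UD : ∀ h p → isFirstPassage h (p ++ U ∷ D ∷ []) ≡ false
isFirstPassage-++UD h       []          = refl
isFirstPassage-++UD h       (U ∷ p)     = isFirstPassage-++UD (suc h) p
isFirstPassage-++UD zero    (D ∷ [])    = refl
isFirstPassage-++UD zero    (D ∷ _ ∷ p) = refl
isFirstPassage-++UD (suc h) (D ∷ p)     = isFirstPassage-++UD h p

cyclicSum-removeUD : ∀ L p c q → L ≤ length p →
  cyclicSum L firstPassage (p ++ U ∷ D ∷ c ∷ q) ≡ cyclicSum L firstPassage (p ++ c ∷ q)
cyclicSum-removeUD zero    p       c q _ = refl
cyclicSum-removeUD (suc L) (a ∷ p) c q (s≤s L≤p) = cong₂ _+_
  (cong ⟦_⟧ (isFirstPassage-removeUD 0 (a ∷ p) c q))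
  (begin
    cyclicSum L firstPassage ((p ++ U ∷ D ∷ c ∷ q) ∷ʳ a) ≡⟨ cong (cyclicSum L firstPassage) (++-assoc p _ (a ∷ [])) ⟩
    cyclicSum L firstPassage (p ++ U ∷ D ∷ c ∷ q ∷ʳ a)   ≡⟨ cyclicSum-removeUD L p c (q ∷ʳ a) L≤p ⟩
    cyclicSum L firstPassage (p ++ c ∷ q ∷ʳ a)           ≡⟨ cong (cyclicSum L firstPassage) (++-assoc p _ (a ∷ [])) ⟨
    cyclicSum L firstPassage ((p ++ c ∷ q) ∷ʳ a)         ∎)
  where open ≡-Reasoning

-- Of the rotations of U ∷ D ∷ a ∷ z, the one starting with this D and the one ending with this
-- U ∷ D are never first passages; every other one is a rotation of a ∷ z with U ∷ D inserted.
firstPassageRotations-removeUD : ∀ z → firstPassageRotations (U ∷ D ∷ z) ≡ firstPassageRotations z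
firstPassageRotations-removeUD []      = refl
firstPassageRotations-removeUD (a ∷ z) = begin
  firstPassage (a ∷ z) + (firstPassage (D ∷ (a ∷ z) ∷ʳ U)
    + cyclicSum (suc (length z)) firstPassage (a ∷ (z ∷ʳ U) ∷ʳ D))
    ≡⟨ cong (λ u → firstPassage (a ∷ z) + cyclicSum (suc (length z)) firstPassage (a ∷ u))
            (++-assoc z (U ∷ []) (D ∷ [])) ⟩
  firstPassage (a ∷ z) + (⟦ isFirstPassage 0 ((a ∷ z) ++ U ∷ D ∷ []) ⟧
    + cyclicSum (length z) firstPassage ((z ++ U ∷ D ∷ []) ∷ʳ a))
    ≡⟨ cong (λ b → firstPassage (a ∷ z) + (⟦ b ⟧ + cyclicSum (length z) firstPassage ((z ++ U ∷ D ∷ []) ∷ʳ a)))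
            (isFirstPassage-++UD 0 (a ∷ z)) ⟩
  firstPassage (a ∷ z) + cyclicSum (length z) firstPassage ((z ++ U ∷ D ∷ []) ∷ʳ a)
    ≡⟨ cong (λ u → firstPassage (a ∷ z) + cyclicSum (length z) firstPassage u) (++-assoc z (U ∷ D ∷ []) (a ∷ [])) ⟩
  firstPassage (a ∷ z) + cyclicSum (length z) firstPassage (z ++ U ∷ D ∷ a ∷ [])
    ≡⟨ cong (firstPassage (a ∷ z) +_) (cyclicSum-removeUD (length z) z a [] ≤-refl) ⟩
  firstPassage (a ∷ z) + cyclicSum (length z) firstPassage (z ∷ʳ a) ∎
  where open ≡-Reasoning

containsUD⊎sorted : ∀ v → (∃₂ λ x t → v ≡ x ++ U ∷ D ∷ t) ⊎ (∃₂ λ i j → v ≡ replicate i D ++ replicate j U)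
containsUD⊎sorted []      = inj₂ (0 , 0 , refl)
containsUD⊎sorted (D ∷ v) with containsUD⊎sorted v
... | inj₁ (x , t , refl) = inj₁ (D ∷ x , t , refl)
... | inj₂ (i , j , refl) = inj₂ (suc i , j , refl)
containsUD⊎sorted (U ∷ v) with containsUD⊎sorted v
... | inj₁ (x , t , refl)     = inj₁ (U ∷ x , t , refl)
... | inj₂ (zero , j , refl)  = inj₂ (0 , suc j , refl)
... | inj₂ (suc i , j , refl) = inj₁ ([] , replicate i D ++ replicate j U , refl)

#U-sorted : ∀ i j → #U (replicate i D ++ replicate j U) ≡ j
#U-sorted (suc i) j       = #U-sorted i j
#U-sorted zero    zero    = refl
#U-sorted zero    (suc j) = cong suc (#U-sorted 0 j)

#D-sorted : ∀ i j → #D (replicate i D ++ replicate j U) ≡ i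
#D-sorted (suc i) j       = cong suc (#D-sorted i j)
#D-sorted zero    zero    = refl
#D-sorted zero    (suc j) = #D-sorted 0 j

replicate-suc : ∀ j (x : Step) → replicate (suc j) x ≡ replicate j x ∷ʳ x
replicate-suc zero    x = refl
replicate-suc (suc j) x = cong (x ∷_) (replicate-suc j x)

rotationStartingWithUD : ∀ v {a b} → #U v ≡ suc a → #D v ≡ suc b → ∃₂ λ r z → rotate^ r v ≡ U ∷ D ∷ z
rotationStartingWithUD v eU eD with containsUD⊎sorted v
... | inj₁ (x , t , refl) = length x , t ++ x , rotate^-++ x (U ∷ D ∷ t)
rotationStartingWithUD v {a} {b} eU eD | inj₂ (i , j , refl)
  with trans (sym (#U-sorted i j)) eU | trans (sym (#D-sorted i j)) eD
... | refl | refl = length x , replicate b D ++ replicate a U , (begin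
  rotate^ (length x) (replicate (suc b) D ++ replicate (suc a) U)
    ≡⟨ cong (λ u → rotate^ (length x) (replicate (suc b) D ++ u)) (replicate-suc a U) ⟩
  rotate^ (length x) (replicate (suc b) D ++ replicate a U ∷ʳ U)
    ≡⟨ cong (rotate^ (length x)) (++-assoc (replicate (suc b) D) (replicate a U) (U ∷ [])) ⟨
  rotate^ (length x) (x ∷ʳ U)
    ≡⟨ rotate^-++ x (U ∷ []) ⟩
  U ∷ x ∎)
  where
  open ≡-Reasoning
  x = replicate (suc b) D ++ replicate a U

-- The cycle lemma of Dvoretzky and Motzkin, proved by cancelling a cyclic UD-factor.
firstPassageRotations≡1 : ∀ n v → #U v ≡ n → #D v ≡ suc n → firstPassageRotations v ≡ 1
firstPassageRotations≡1 zero    (D ∷ []) _  _  = refl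
firstPassageRotations≡1 zero    (D ∷ D ∷ v) _  ()
firstPassageRotations≡1 (suc n) v        eU eD with rotationStartingWithUD v eU eD
... | r , z , UDz = begin
  firstPassageRotations v              ≡⟨ rotate^-invariant firstPassageRotations firstPassageRotations-rotate r v ⟨
  firstPassageRotations (rotate^ r v)  ≡⟨ cong firstPassageRotations UDz ⟩
  firstPassageRotations (U ∷ D ∷ z)    ≡⟨ firstPassageRotations-removeUD z ⟩
  firstPassageRotations z              ≡⟨ firstPassageRotations≡1 n z #U-z #D-z ⟩
  1                                    ∎
  where
  open ≡-Reasoning
  #U-z : #U z ≡ n
  #U-z = suc-injective (trans (cong #U (sym UDz)) (trans (rotate^-invariant #U #U-rotate r v) eU))
  #D-z : #D z ≡ suc n
  #D-z = suc-injective (trans (cong #D (sym UDz)) (trans (rotate^-invariant #D #D-rotate r v) eD))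

-- Factors counted along a word and around a cycle

pairSum : (Step → Step → ℕ) → List Step → ℕ
pairSum t (x ∷ y ∷ s) = t x y + pairSum t (y ∷ s)
pairSum t _           = 0

tripleSum : (Step → Step → Step → ℕ) → List Step → ℕ
tripleSum t (x ∷ y ∷ z ∷ s) = t x y z + tripleSum t (y ∷ z ∷ s)
tripleSum t _               = 0

[UD] : Step → Step → ℕ
[UD] U D = 1
[UD] _ _ = 0

[UUD] : Step → Step → Step → ℕ
[UUD] U U D = 1
[UUD] _ _ _ = 0

#UD≡pairSum : ∀ v → #UD v ≡ pairSum [UD] v
#UD≡pairSum []          = refl
#UD≡pairSum (U ∷ [])    = refl
#UD≡pairSum (D ∷ [])    = refl
#UD≡pairSum (U ∷ D ∷ s) = cong suc (#UD≡pairSum (D ∷ s))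
#UD≡pairSum (U ∷ U ∷ s) = #UD≡pairSum (U ∷ s)
#UD≡pairSum (D ∷ y ∷ s) = #UD≡pairSum (y ∷ s)

#UUD≡tripleSum : ∀ v → #UUD v ≡ tripleSum [UUD] v
#UUD≡tripleSum []              = refl
#UUD≡tripleSum (U ∷ [])        = refl
#UUD≡tripleSum (D ∷ [])        = refl
#UUD≡tripleSum (U ∷ U ∷ [])    = refl
#UUD≡tripleSum (U ∷ D ∷ [])    = refl
#UUD≡tripleSum (D ∷ U ∷ [])    = refl
#UUD≡tripleSum (D ∷ D ∷ [])    = refl
#UUD≡tripleSum (U ∷ U ∷ D ∷ s) = cong suc (#UUD≡tripleSum (U ∷ D ∷ s))
#UUD≡tripleSum (U ∷ U ∷ U ∷ s) = #UUD≡tripleSum (U ∷ U ∷ s)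
#UUD≡tripleSum (U ∷ D ∷ z ∷ s) = #UUD≡tripleSum (D ∷ z ∷ s)
#UUD≡tripleSum (D ∷ y ∷ z ∷ s) = #UUD≡tripleSum (y ∷ z ∷ s)

pairSum-∷ʳ : ∀ t p x y → pairSum t (p ++ x ∷ y ∷ []) ≡ pairSum t (p ∷ʳ x) + t x y
pairSum-∷ʳ t []          x y = +-identityʳ (t x y)
pairSum-∷ʳ t (a ∷ [])    x y = reassoc (t a x) (t x y)
  where
  reassoc : ∀ p q → p + (q + 0) ≡ (p + 0) + q
  reassoc = solve-∀
pairSum-∷ʳ t (a ∷ b ∷ p) x y = trans (cong (t a b +_) (pairSum-∷ʳ t (b ∷ p) x y)) (sym (+-assoc (t a b) _ _))

tripleSum-∷ʳ : ∀ t p x y z → tripleSum t (p ++ x ∷ y ∷ z ∷ []) ≡ tripleSum t (p ++ x ∷ y ∷ []) + t x y z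
tripleSum-∷ʳ t []              x y z = +-identityʳ (t x y z)
tripleSum-∷ʳ t (a ∷ [])        x y z = reassoc (t a x y) (t x y z)
  where
  reassoc : ∀ p q → p + (q + 0) ≡ (p + 0) + q
  reassoc = solve-∀
tripleSum-∷ʳ t (a ∷ b ∷ [])    x y z = reassoc (t a b x) (t b x y) (t x y z)
  where
  reassoc : ∀ p q r → p + (q + (r + 0)) ≡ (p + (q + 0)) + r
  reassoc = solve-∀
tripleSum-∷ʳ t (a ∷ b ∷ c ∷ p) x y z =
  trans (cong (t a b c +_) (tripleSum-∷ʳ t (b ∷ c ∷ p) x y z)) (sym (+-assoc (t a b c) _ _))

-- v is read as a cycle, so that these counts are invariant under rotate.
cyclic#UD : List Step → ℕ
cyclic#UD v = pairSum [UD] (v ++ take 1 v)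

cyclic#UUD : List Step → ℕ
cyclic#UUD v = tripleSum [UUD] (v ++ take 2 v)

cyclic#UD-rotate : ∀ v → cyclic#UD (rotate v) ≡ cyclic#UD v
cyclic#UD-rotate []          = refl
cyclic#UD-rotate (a ∷ [])    = refl
cyclic#UD-rotate (a ∷ b ∷ r) = begin
  pairSum [UD] (((b ∷ r) ∷ʳ a) ∷ʳ b)    ≡⟨ cong (pairSum [UD]) (++-assoc (b ∷ r) (a ∷ []) (b ∷ [])) ⟩
  pairSum [UD] ((b ∷ r) ++ a ∷ b ∷ [])  ≡⟨ pairSum-∷ʳ [UD] (b ∷ r) a b ⟩
  pairSum [UD] ((b ∷ r) ∷ʳ a) + [UD] a b ≡⟨ +-comm _ ([UD] a b) ⟩
  pairSum [UD] (a ∷ b ∷ r ∷ʳ a)         ∎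
  where open ≡-Reasoning

cyclic#UUD-rotate : ∀ v → cyclic#UUD (rotate v) ≡ cyclic#UUD v
cyclic#UUD-rotate []              = refl
cyclic#UUD-rotate (a ∷ [])        = refl
cyclic#UUD-rotate (a ∷ b ∷ [])    = swap ([UUD] b a b) ([UUD] a b a)
  where
  swap : ∀ p q → p + (q + 0) ≡ q + (p + 0)
  swap = solve-∀
cyclic#UUD-rotate (a ∷ b ∷ c ∷ r) = begin
  tripleSum [UUD] (((b ∷ c ∷ r) ∷ʳ a) ++ b ∷ c ∷ [])       ≡⟨ cong (tripleSum [UUD]) (++-assoc (b ∷ c ∷ r) (a ∷ []) (b ∷ c ∷ [])) ⟩
  tripleSum [UUD] ((b ∷ c ∷ r) ++ a ∷ b ∷ c ∷ [])          ≡⟨ tripleSum-∷ʳ [UUD] (b ∷ c ∷ r) a b c ⟩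
  tripleSum [UUD] ((b ∷ c ∷ r) ++ a ∷ b ∷ []) + [UUD] a b c ≡⟨ +-comm _ ([UUD] a b c) ⟩
  tripleSum [UUD] (a ∷ b ∷ c ∷ r ++ a ∷ b ∷ [])            ∎
  where open ≡-Reasoning

-- A D can only be the last letter of a UD- or UUD-window.
pairSum-++D∷ : ∀ q r → pairSum [UD] (q ++ D ∷ r) ≡ pairSum [UD] (q ∷ʳ D) + pairSum [UD] r
pairSum-++D∷ []          []      = refl
pairSum-++D∷ []          (_ ∷ _) = refl
pairSum-++D∷ (a ∷ [])    r       = trans (cong ([UD] a D +_) (pairSum-++D∷ [] r))
                                          (cong (_+ pairSum [UD] r) (sym (+-identityʳ ([UD] a D))))
pairSum-++D∷ (a ∷ b ∷ q) r       =
  trans (cong ([UD] a b +_) (pairSum-++D∷ (b ∷ q) r)) (sym (+-assoc ([UD] a b) _ _))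

tripleSum-D∷ : ∀ s → tripleSum [UUD] (D ∷ s) ≡ tripleSum [UUD] s
tripleSum-D∷ []          = refl
tripleSum-D∷ (_ ∷ [])    = refl
tripleSum-D∷ (_ ∷ _ ∷ _) = refl

tripleSum-++D∷ : ∀ q r → tripleSum [UUD] (q ++ D ∷ r) ≡ tripleSum [UUD] (q ∷ʳ D) + tripleSum [UUD] r
tripleSum-++D∷ []              r       = tripleSum-D∷ r
tripleSum-++D∷ (_ ∷ [])        []      = refl
tripleSum-++D∷ (U ∷ [])        (c ∷ r) = tripleSum-D∷ (c ∷ r)
tripleSum-++D∷ (D ∷ [])        (c ∷ r) = tripleSum-D∷ (c ∷ r)
tripleSum-++D∷ (a ∷ b ∷ [])    r       =
  trans (cong ([UUD] a b D +_) (tripleSum-++D∷ (b ∷ []) r))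
        (cong (_+ tripleSum [UUD] r) (sym (+-identityʳ ([UUD] a b D))))
tripleSum-++D∷ (a ∷ b ∷ c ∷ q) r       =
  trans (cong ([UUD] a b c +_) (tripleSum-++D∷ (b ∷ c ∷ q) r)) (sym (+-assoc ([UUD] a b c) _ _))

cyclic#UD-∷ʳD : ∀ p → cyclic#UD (p ∷ʳ D) ≡ #UD (p ∷ʳ D)
cyclic#UD-∷ʳD p = begin
  pairSum [UD] ((p ∷ʳ D) ++ take 1 (p ∷ʳ D))                ≡⟨ cong (pairSum [UD]) (++-assoc p (D ∷ []) _) ⟩
  pairSum [UD] (p ++ D ∷ take 1 (p ∷ʳ D))                   ≡⟨ pairSum-++D∷ p _ ⟩
  pairSum [UD] (p ∷ʳ D) + pairSum [UD] (take 1 (p ∷ʳ D))    ≡⟨ cong (pairSum [UD] (p ∷ʳ D) +_) (short (p ∷ʳ D)) ⟩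
  pairSum [UD] (p ∷ʳ D) + 0                                 ≡⟨ +-identityʳ _ ⟩
  pairSum [UD] (p ∷ʳ D)                                     ≡⟨ #UD≡pairSum (p ∷ʳ D) ⟨
  #UD (p ∷ʳ D)                                              ∎
  where
  open ≡-Reasoning
  short : ∀ s → pairSum [UD] (take 1 s) ≡ 0
  short []      = refl
  short (_ ∷ _) = refl

cyclic#UUD-∷ʳD : ∀ p → cyclic#UUD (p ∷ʳ D) ≡ #UUD (p ∷ʳ D)
cyclic#UUD-∷ʳD p = begin
  tripleSum [UUD] ((p ∷ʳ D) ++ take 2 (p ∷ʳ D))                ≡⟨ cong (tripleSum [UUD]) (++-assoc p (D ∷ []) _) ⟩
  tripleSum [UUD] (p ++ D ∷ take 2 (p ∷ʳ D))                   ≡⟨ tripleSum-++D∷ p _ ⟩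
  tripleSum [UUD] (p ∷ʳ D) + tripleSum [UUD] (take 2 (p ∷ʳ D)) ≡⟨ cong (tripleSum [UUD] (p ∷ʳ D) +_) (short (p ∷ʳ D)) ⟩
  tripleSum [UUD] (p ∷ʳ D) + 0                                 ≡⟨ +-identityʳ _ ⟩
  tripleSum [UUD] (p ∷ʳ D)                                     ≡⟨ #UUD≡tripleSum (p ∷ʳ D) ⟨
  #UUD (p ∷ʳ D)                                                ∎
  where
  open ≡-Reasoning
  short : ∀ s → tripleSum [UUD] (take 2 s) ≡ 0
  short []          = refl
  short (_ ∷ [])    = refl
  short (_ ∷ _ ∷ _) = refl

cyclic#UD-D∷ : ∀ p → cyclic#UD (D ∷ p) ≡ #UD (p ∷ʳ D)
cyclic#UD-D∷ []      = refl
cyclic#UD-D∷ (x ∷ p) = sym (#UD≡pairSum (x ∷ p ∷ʳ D))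

cyclic#UUD-D∷ : ∀ p → cyclic#UUD (D ∷ p) ≡ #UUD (p ∷ʳ D)
cyclic#UUD-D∷ p = begin
  tripleSum [UUD] (D ∷ p ++ D ∷ take 1 p)                ≡⟨ tripleSum-D∷ (p ++ D ∷ take 1 p) ⟩
  tripleSum [UUD] (p ++ D ∷ take 1 p)                    ≡⟨ tripleSum-++D∷ p _ ⟩
  tripleSum [UUD] (p ∷ʳ D) + tripleSum [UUD] (take 1 p)  ≡⟨ cong (tripleSum [UUD] (p ∷ʳ D) +_) (short p) ⟩
  tripleSum [UUD] (p ∷ʳ D) + 0                           ≡⟨ +-identityʳ _ ⟩
  tripleSum [UUD] (p ∷ʳ D)                               ≡⟨ #UUD≡tripleSum (p ∷ʳ D) ⟨
  #UUD (p ∷ʳ D)                                          ∎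
  where
  open ≡-Reasoning
  short : ∀ s → tripleSum [UUD] (take 1 s) ≡ 0
  short []      = refl
  short (_ ∷ _) = refl

isFirstPassage-∷ʳU : ∀ h p → isFirstPassage h (p ∷ʳ U) ≡ false
isFirstPassage-∷ʳU h       []          = refl
isFirstPassage-∷ʳU h       (U ∷ p)     = isFirstPassage-∷ʳU (suc h) p
isFirstPassage-∷ʳU zero    (D ∷ [])    = refl
isFirstPassage-∷ʳU zero    (D ∷ _ ∷ p) = refl
isFirstPassage-∷ʳU (suc h) (D ∷ p)     = isFirstPassage-∷ʳU h p

isFirstPassage-∷ʳD : ∀ h p → isFirstPassage h (p ∷ʳ D) ≡ prefixOK h p ∧ (#D p ≡ᵇ h + #U p)
isFirstPassage-∷ʳD zero    []          = refl
isFirstPassage-∷ʳD (suc h) []          = refl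
isFirstPassage-∷ʳD h       (U ∷ p)     rewrite +-suc h (#U p) = isFirstPassage-∷ʳD (suc h) p
isFirstPassage-∷ʳD zero    (D ∷ [])    = refl
isFirstPassage-∷ʳD zero    (D ∷ _ ∷ p) = refl
isFirstPassage-∷ʳD (suc h) (D ∷ p)     = isFirstPassage-∷ʳD h p

≡ᵇ-true⇒≡ : ∀ x y → (x ≡ᵇ y) ≡ true → x ≡ y
≡ᵇ-true⇒≡ x y e = ≡ᵇ⇒≡ x y (Equivalence.from T-≡ e)

isDyck≡isFirstPassage-∷ʳD : ∀ n p → isDyck n p ≡ isFirstPassage 0 (p ∷ʳ D) ∧ (#U p ≡ᵇ n)
isDyck≡isFirstPassage-∷ʳD n p rewrite isFirstPassage-∷ʳD 0 p with #U p ≡ᵇ n in #U≡n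
... | false = sym (∧-zeroʳ _)
... | true  rewrite ≡ᵇ-true⇒≡ (#U p) n #U≡n =
  trans (∧-comm (#D p ≡ᵇ n) (prefixOK 0 p)) (sym (∧-identityʳ _))

-- A first passage p ∷ʳ D has p empty or ending in D, so the final D creates no factor.
#UD,#UUD-firstPassage : ∀ p → isFirstPassage 0 (p ∷ʳ D) ≡ true →
  #UD (p ∷ʳ D) ≡ #UD p × #UUD (p ∷ʳ D) ≡ #UUD p
#UD,#UUD-firstPassage p fp with initLast p
... | []       = refl , refl
... | q ∷ʳ′ U  with () ← trans (sym fp) (trans (cong (isFirstPassage 0) (++-assoc q (U ∷ []) (D ∷ []))) (isFirstPassage-++UD 0 q))
... | q ∷ʳ′ D  =
  trans (#UD≡pairSum (q ∷ʳ D ∷ʳ D)) (trans (cong (pairSum [UD]) (++-assoc q (D ∷ []) (D ∷ [])))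
    (trans (pairSum-++D∷ q (D ∷ [])) (trans (+-identityʳ _) (sym (#UD≡pairSum (q ∷ʳ D)))))) ,
  trans (#UUD≡tripleSum (q ∷ʳ D ∷ʳ D)) (trans (cong (tripleSum [UUD]) (++-assoc q (D ∷ []) (D ∷ [])))
    (trans (tripleSum-++D∷ q (D ∷ [])) (trans (+-identityʳ _) (sym (#UUD≡tripleSum (q ∷ʳ D))))))

#D≡#U-firstPassage : ∀ p → isFirstPassage 0 (p ∷ʳ D) ≡ true → #D p ≡ #U p
#D≡#U-firstPassage p fp = ≡ᵇ⇒≡ (#D p) (#U p)
  (proj₂ (Equivalence.to T-∧ (Equivalence.from T-≡ (trans (sym (isFirstPassage-∷ʳD 0 p)) fp))))

#U-∷ʳD : ∀ p → #U (p ∷ʳ D) ≡ #U p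
#U-∷ʳD p = trans (#U-++ p (D ∷ [])) (+-identityʳ (#U p))

#D-∷ʳD : ∀ p → #D (p ∷ʳ D) ≡ suc (#D p)
#D-∷ʳD p = trans (#D-++ p (D ∷ [])) (+-comm (#D p) 1)

∧-dup : ∀ a x → a ∧ (a ∧ x) ≡ a ∧ x
∧-dup true  x = refl
∧-dup false x = refl

startsWithD : List Step → ℕ
startsWithD (D ∷ _) = 1
startsWithD _       = 0

cyclicSum-startsWithD : ∀ x y → cyclicSum (length x) startsWithD (x ++ y) ≡ #D x
cyclicSum-startsWithD []      y = refl
cyclicSum-startsWithD (U ∷ x) y =
  trans (cong (cyclicSum (length x) startsWithD) (++-assoc x y (U ∷ []))) (cyclicSum-startsWithD x (y ∷ʳ U))
cyclicSum-startsWithD (D ∷ x) y = cong suc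
  (trans (cong (cyclicSum (length x) startsWithD) (++-assoc x y (D ∷ []))) (cyclicSum-startsWithD x (y ∷ʳ D)))

-- Counting words by their runs

x*[y*0]≡0 : ∀ x y → x * (y * 0) ≡ 0
x*[y*0]≡0 x y = trans (cong (x *_) (*-zeroʳ y)) (*-zeroʳ x)

HasCounts : List Step → ℕ → ℕ → ℕ → ℕ → List Step → Bool
HasCounts pre a b k m p =
  (#U p ≡ᵇ a) ∧ (#D p ≡ᵇ b) ∧ (#UD (pre ++ p ∷ʳ D) ≡ᵇ k) ∧ (#UUD (pre ++ p ∷ʳ D) ≡ᵇ m)

binom : ℕ → ℕ → ℕ
binom n       zero    = 1
binom zero    (suc k) = 0
binom (suc n) (suc k) = binom n k + binom n (suc k)

compositions : ℕ → ℕ → ℕ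
compositions zero    zero    = 1
compositions zero    (suc m) = 0
compositions (suc t) zero    = 0
compositions (suc t) (suc m) = binom t m

-- The number of ways to split a U's into k runs such that m prescribed runs have length ≥ 2
-- and the others length 1: the a − k surplus U's form a composition into m parts.
spread : ℕ → ℕ → ℕ → ℕ
spread a       zero    m = compositions a m
spread zero    (suc k) m = 0
spread (suc a) (suc k) m = spread a k m

-- The letters before the unread part of a word, as far as UD- and UUD-factors are concerned.
data Tail : Set where
  afterD afterU afterUU : Tail

prefix : Tail → List Step
prefix afterD  = []
prefix afterU  = U ∷ []
prefix afterUU = U ∷ U ∷ []

next : Tail → Tail
next afterD  = afterU
next afterU  = afterUU
next afterUU = afterUU

-- The closed forms for Σ-words (a + b) (⟦_⟧ ∘ HasCounts (prefix s) a b k m). For s = afterD the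
-- k UD-factors are the ends of the k U-runs, binom (suc b) k places the b + 1 D's into an initial
-- run and k nonempty runs, and binom k m chooses the U-runs of length ≥ 2.
runCount : Tail → ℕ → ℕ → ℕ → ℕ → ℕ
runCount afterD  a b k             m       = binom (suc b) k * (binom k m * spread a k m)
runCount afterU  a b zero          m       = 0
runCount afterU  a b (suc k)       m       = binom b k * (binom (suc k) m * spread (suc a) (suc k) m)
runCount afterUU a b zero          m       = 0
runCount afterUU a b (suc k)       zero    = 0
runCount afterUU a b (suc k)       (suc m) = binom b k * (binom k m * spread (suc (suc a)) (suc k) (suc m))

viaU : Tail → ℕ → ℕ → ℕ → ℕ → ℕ
viaU s zero    b k m = 0
viaU s (suc a) b k m = runCount (next s) a b k m

viaD : Tail → ℕ → ℕ → ℕ → ℕ → ℕ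
viaD afterD  a (suc b) k       m       = runCount afterD a b k m
viaD afterU  a (suc b) (suc k) m       = runCount afterD a b k m
viaD afterUU a (suc b) (suc k) (suc m) = runCount afterD a b k m
viaD _       _ _       _       _       = 0

runCount-empty : ∀ s k m → ⟦ HasCounts (prefix s) 0 0 k m [] ⟧ ≡ runCount s 0 0 k m
runCount-empty afterD  zero          zero          = refl
runCount-empty afterD  zero          (suc m)       = refl
runCount-empty afterD  (suc k)       m             = sym (x*[y*0]≡0 (binom 1 (suc k)) (binom (suc k) m))
runCount-empty afterU  zero          m             = refl
runCount-empty afterU  (suc zero)    zero          = refl
runCount-empty afterU  (suc zero)    (suc m)       = sym (trans (+-identityʳ _) (*-zeroʳ (binom 1 (suc m))))
runCount-empty afterU  (suc (suc k)) m             = refl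
runCount-empty afterUU zero          m             = refl
runCount-empty afterUU (suc zero)    zero          = refl
runCount-empty afterUU (suc (suc k)) zero          = refl
runCount-empty afterUU (suc zero)    (suc zero)    = refl
runCount-empty afterUU (suc zero)    (suc (suc m)) = refl
runCount-empty afterUU (suc (suc k)) (suc m)       = refl

spread-zero : ∀ k m → spread 0 k (suc m) ≡ 0
spread-zero zero    m = refl
spread-zero (suc k) m = refl

spread-pascal : ∀ a k m → spread (suc a) k (suc m) ≡ spread a k (suc m) + spread a k m
spread-pascal zero    zero    zero    = refl
spread-pascal zero    zero    (suc m) = refl
spread-pascal (suc a) zero    zero    = refl
spread-pascal (suc a) zero    (suc m) = +-comm (binom a m) _
spread-pascal zero    (suc k) m       = spread-zero k m
spread-pascal (suc a) (suc k) m       = spread-pascal a k m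

runCount-recurrence : ∀ s a b k m → viaU s (suc a) b k m + viaD s (suc a) b k m ≡ runCount s (suc a) b k m
runCount-recurrence afterD  a zero    zero          zero          = refl
runCount-recurrence afterD  a zero    zero          (suc m)       = refl
runCount-recurrence afterD  a zero    (suc k)       m             =
  trans (+-identityʳ _) (cong (_* (binom (suc k) m * spread (suc a) (suc k) m)) (sym (+-identityʳ (binom 0 k))))
runCount-recurrence afterD  a (suc b) zero          m             = refl
runCount-recurrence afterD  a (suc b) (suc k)       m             =
  sym (*-distribʳ-+ (binom (suc k) m * spread (suc a) (suc k) m) (binom (suc b) k) _)
runCount-recurrence afterU  a zero    zero          m             = refl
runCount-recurrence afterU  a (suc b) zero          m             = refl
runCount-recurrence afterU  a zero    (suc zero)    zero          = refl
runCount-recurrence afterU  a zero    (suc (suc k)) zero          = refl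
runCount-recurrence afterU  a (suc b) (suc k)       zero          = refl
runCount-recurrence afterU  a zero    (suc zero)    (suc m)       =
  trans (+-identityʳ _) (cong (λ x → 1 * (x * spread (suc (suc a)) 1 (suc m))) (sym (+-identityʳ (binom 0 m))))
runCount-recurrence afterU  a zero    (suc (suc k)) (suc m)       = refl
runCount-recurrence afterU  a (suc b) (suc k)       (suc m)       =
  trans (sym (*-distribˡ-+ (binom (suc b) k) _ _))
        (cong (binom (suc b) k *_) (sym (*-distribʳ-+ (spread (suc a) k (suc m)) (binom k m) _)))
runCount-recurrence afterUU a zero    zero          m             = refl
runCount-recurrence afterUU a (suc b) zero          m             = refl
runCount-recurrence afterUU a zero    (suc k)       zero          = refl
runCount-recurrence afterUU a (suc b) (suc k)       zero          = refl
runCount-recurrence afterUU a zero    (suc zero)    (suc zero)    = refl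
runCount-recurrence afterUU a zero    (suc zero)    (suc (suc m)) = refl
runCount-recurrence afterUU a zero    (suc (suc k)) (suc m)       = refl
runCount-recurrence afterUU a (suc b) (suc k)       (suc m)       =
  trans (sym (*-distribˡ-+ (binom (suc b) k) _ _))
        (cong (binom (suc b) k *_) (trans (sym (*-distribˡ-+ (binom k m) _ _))
                                          (cong (binom k m *_) (sym (spread-pascal (suc a) k m)))))

runCount-recurrence-noU : ∀ s b k m → viaU s 0 (suc b) k m + viaD s 0 (suc b) k m ≡ runCount s 0 (suc b) k m
runCount-recurrence-noU afterD  b zero          m       = refl
runCount-recurrence-noU afterD  b (suc k)       m       =
  trans (x*[y*0]≡0 (binom (suc b) (suc k)) (binom (suc k) m)) (sym (x*[y*0]≡0 (binom (suc (suc b)) (suc k)) (binom (suc k) m)))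
runCount-recurrence-noU afterU  b zero          m       = refl
runCount-recurrence-noU afterU  b (suc zero)    zero    = refl
runCount-recurrence-noU afterU  b (suc zero)    (suc m) =
  trans (x*[y*0]≡0 (binom (suc b) 0) (binom 0 (suc m))) (sym (x*[y*0]≡0 (binom (suc b) 0) (binom 1 (suc m))))
runCount-recurrence-noU afterU  b (suc (suc k)) m       =
  trans (x*[y*0]≡0 (binom (suc b) (suc k)) (binom (suc k) m)) (sym (x*[y*0]≡0 (binom (suc b) (suc k)) (binom (suc (suc k)) m)))
runCount-recurrence-noU afterUU b zero          m       = refl
runCount-recurrence-noU afterUU b (suc k)       zero    = refl
runCount-recurrence-noU afterUU b (suc k)       (suc m) =
  cong (λ x → binom (suc b) k * (binom k m * x)) (sym (trans (spread-pascal 0 k m) (cong (_+ spread 0 k m) (spread-zero k m))))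

Σ-words-false : ∀ ℓ (P : List Step → Bool) → (∀ p → P p ≡ false) → Σ-words ℓ (⟦_⟧ ∘ P) ≡ 0
Σ-words-false ℓ P P≡false = trans (Σ-words-cong ℓ (λ p _ → cong ⟦_⟧ (P≡false p))) (Σ-words-0 ℓ)

∧-falseʳ : ∀ x {y} → y ≡ false → x ∧ y ≡ false
∧-falseʳ x refl = ∧-zeroʳ x

Σ-HasCounts≡runCount : ∀ ℓ s a b k m → a + b ≡ ℓ →
  Σ-words ℓ (⟦_⟧ ∘ HasCounts (prefix s) a b k m) ≡ runCount s a b k m
Σ-HasCounts≡runCount zero    s zero    zero    k m refl    = runCount-empty s k m
Σ-HasCounts≡runCount (suc ℓ) s a       b       k m a+b≡1+ℓ =
  trans (cong₂ _+_ (firstU s a b k m a+b≡1+ℓ) (firstD s a b k m a+b≡1+ℓ)) (recurrence a b a+b≡1+ℓ)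
  where
  counts : ∀ s a b k m → List Step → ℕ
  counts s a b k m = ⟦_⟧ ∘ HasCounts (prefix s) a b k m

  a+b≡ℓ : ∀ {a b} → a + suc b ≡ suc ℓ → a + b ≡ ℓ
  a+b≡ℓ {a} {b} e = suc-injective (trans (sym (+-suc a b)) e)

  firstU : ∀ s a b k m → a + b ≡ suc ℓ → Σ-words ℓ (counts s a b k m ∘ (U ∷_)) ≡ viaU s a b k m
  firstU s       zero    b k m _ = Σ-words-0 ℓ
  firstU afterD  (suc a) b k m e = Σ-HasCounts≡runCount ℓ afterU  a b k m (suc-injective e)
  firstU afterU  (suc a) b k m e = Σ-HasCounts≡runCount ℓ afterUU a b k m (suc-injective e)
  firstU afterUU (suc a) b k m e = Σ-HasCounts≡runCount ℓ afterUU a b k m (suc-injective e)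

  firstD : ∀ s a b k m → a + b ≡ suc ℓ → Σ-words ℓ (counts s a b k m ∘ (D ∷_)) ≡ viaD s a b k m
  firstD afterD  a zero    k       m       _ = Σ-words-false ℓ _ (λ p → ∧-zeroʳ (#U p ≡ᵇ a))
  firstD afterU  a zero    k       m       _ = Σ-words-false ℓ _ (λ p → ∧-zeroʳ (#U p ≡ᵇ a))
  firstD afterUU a zero    k       m       _ = Σ-words-false ℓ _ (λ p → ∧-zeroʳ (#U p ≡ᵇ a))
  firstD afterU  a (suc b) zero    m       _ = Σ-words-false ℓ _ (λ p → ∧-falseʳ (#U p ≡ᵇ a) (∧-zeroʳ _))
  firstD afterUU a (suc b) zero    m       _ = Σ-words-false ℓ _ (λ p → ∧-falseʳ (#U p ≡ᵇ a) (∧-zeroʳ _))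
  firstD afterUU a (suc b) (suc k) zero    _ =
    Σ-words-false ℓ _ (λ p → ∧-falseʳ (#U p ≡ᵇ a) (∧-falseʳ (#D p ≡ᵇ b) (∧-zeroʳ _)))
  firstD afterD  a (suc b) k       m       e = Σ-HasCounts≡runCount ℓ afterD a b k m (a+b≡ℓ e)
  firstD afterU  a (suc b) (suc k) m       e = Σ-HasCounts≡runCount ℓ afterD a b k m (a+b≡ℓ e)
  firstD afterUU a (suc b) (suc k) (suc m) e = Σ-HasCounts≡runCount ℓ afterD a b k m (a+b≡ℓ e)

  recurrence : ∀ a b → a + b ≡ suc ℓ → viaU s a b k m + viaD s a b k m ≡ runCount s a b k m
  recurrence (suc a) b       _ = runCount-recurrence s a b k m
  recurrence zero    (suc b) _ = runCount-recurrence-noU s b k m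

-- Double counting over rotation classes

module CyclicClass (n k m : ℕ) where

  inClass : List Step → Bool
  inClass v = (#U v ≡ᵇ n) ∧ (#D v ≡ᵇ suc n) ∧ (cyclic#UD v ≡ᵇ k) ∧ (cyclic#UUD v ≡ᵇ m)

  χ : List Step → ℕ
  χ v = ⟦ inClass v ⟧

  χ-rotate : ∀ v → χ (rotate v) ≡ χ v
  χ-rotate v rewrite #U-rotate v | #D-rotate v | cyclic#UD-rotate v | cyclic#UUD-rotate v = refl

  χ*firstPassageRotations : ∀ v → χ v * firstPassageRotations v ≡ χ v
  χ*firstPassageRotations v with #U v ≡ᵇ n in #U≡n | #D v ≡ᵇ suc n in #D≡1+n
  ... | false | _     = refl
  ... | true  | false = refl
  ... | true  | true  rewrite firstPassageRotations≡1 n v (≡ᵇ-true⇒≡ (#U v) n #U≡n) (≡ᵇ-true⇒≡ (#D v) (suc n) #D≡1+n) =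
    *-identityʳ _

  χ*#D : ∀ v → χ v * #D v ≡ suc n * χ v
  χ*#D v with #U v ≡ᵇ n | #D v ≡ᵇ suc n in #D≡1+n
  ... | false | _     = sym (*-zeroʳ (suc n))
  ... | true  | false = sym (*-zeroʳ (suc n))
  ... | true  | true  = trans (cong (⟦ (cyclic#UD v ≡ᵇ k) ∧ (cyclic#UUD v ≡ᵇ m) ⟧ *_) (≡ᵇ-true⇒≡ (#D v) (suc n) #D≡1+n))
                                (*-comm _ (suc n))

  L : ℕ
  L = suc (n + n)

  Σ-χ≡L*Σ-χ·firstPassage : Σ-words L χ ≡ L * Σ-words L (λ v → χ v * firstPassage v)
  Σ-χ≡L*Σ-χ·firstPassage = begin
    Σ-words L χ                                             ≡⟨ Σ-words-cong L (λ v _ → χ*firstPassageRotations v) ⟨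
    Σ-words L (λ v → χ v * firstPassageRotations v)         ≡⟨ Σ-words-cong L (λ v ∣v∣ → cong (λ l → χ v * cyclicSum l firstPassage v) ∣v∣) ⟩
    Σ-words L (λ v → χ v * cyclicSum L firstPassage v)      ≡⟨ Σ-words-cong L (λ v _ → cyclicSum-*ˡ χ χ-rotate L firstPassage v) ⟨
    Σ-words L (cyclicSum L (λ v → χ v * firstPassage v))    ≡⟨ Σ-words-cyclicSum L L _ ⟩
    L * Σ-words L (λ v → χ v * firstPassage v)              ∎
    where open ≡-Reasoning

  [1+n]*Σ-χ≡L*Σ-χ·startsWithD : suc n * Σ-words L χ ≡ L * Σ-words L (λ v → χ v * startsWithD v)
  [1+n]*Σ-χ≡L*Σ-χ·startsWithD = begin
    suc n * Σ-words L χ                                     ≡⟨ Σ-words-*ˡ L (suc n) χ ⟨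
    Σ-words L (λ v → suc n * χ v)                           ≡⟨ Σ-words-cong L (λ v ∣v∣ → trans (cong (χ v *_) (#D-as-cyclicSum v ∣v∣)) (χ*#D v)) ⟨
    Σ-words L (λ v → χ v * cyclicSum L startsWithD v)       ≡⟨ Σ-words-cong L (λ v _ → cyclicSum-*ˡ χ χ-rotate L startsWithD v) ⟨
    Σ-words L (cyclicSum L (λ v → χ v * startsWithD v))     ≡⟨ Σ-words-cyclicSum L L _ ⟩
    L * Σ-words L (λ v → χ v * startsWithD v)               ∎
    where
    open ≡-Reasoning
    #D-as-cyclicSum : ∀ v → length v ≡ L → cyclicSum L startsWithD v ≡ #D v
    #D-as-cyclicSum v ∣v∣ = begin
      cyclicSum L startsWithD v                 ≡⟨ cong (λ l → cyclicSum l startsWithD v) ∣v∣ ⟨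
      cyclicSum (length v) startsWithD v        ≡⟨ cong (cyclicSum (length v) startsWithD) (++-identityʳ v) ⟨
      cyclicSum (length v) startsWithD (v ++ []) ≡⟨ cyclicSum-startsWithD v [] ⟩
      #D v                                      ∎

  -- The class is closed under rotation, and each of its words has exactly one rotation that is a
  -- first passage (the cycle lemma) but n + 1 rotations starting with D.
  doubleCounting : suc n * Σ-words L (λ v → χ v * firstPassage v) ≡ Σ-words L (λ v → χ v * startsWithD v)
  doubleCounting = *-cancelˡ-≡ _ _ L (begin
    L * (suc n * Σ-words L (λ v → χ v * firstPassage v)) ≡⟨ x*[y*z]≡y*[x*z] L (suc n) _ ⟩
    suc n * (L * Σ-words L (λ v → χ v * firstPassage v)) ≡⟨ cong (suc n *_) Σ-χ≡L*Σ-χ·firstPassage ⟨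
    suc n * Σ-words L χ                                  ≡⟨ [1+n]*Σ-χ≡L*Σ-χ·startsWithD ⟩
    L * Σ-words L (λ v → χ v * startsWithD v)            ∎)
    where open ≡-Reasoning

  Σ-χ·firstPassage≡w : Σ-words L (λ v → χ v * firstPassage v) ≡ w n k m
  Σ-χ·firstPassage≡w = begin
    Σ-words L (λ v → χ v * firstPassage v)
      ≡⟨ Σ-words-∷ʳ (n + n) (λ v → χ v * firstPassage v) ⟩
    Σ-words (n + n) (λ p → χ (p ∷ʳ U) * firstPassage (p ∷ʳ U)) + Σ-words (n + n) (λ p → χ (p ∷ʳ D) * firstPassage (p ∷ʳ D))
      ≡⟨ cong₂ _+_ (trans (Σ-words-cong (n + n) (λ p _ → endsInU p)) (Σ-words-0 (n + n)))
                   (Σ-words-cong (n + n) (λ p _ → endsInD p)) ⟩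
    Σ-words (n + n) (⟦_⟧ ∘ isCounted)
      ≡⟨ sum-map-words (n + n) _ ⟨
    sum (map (⟦_⟧ ∘ isCounted) (words (n + n)))
      ≡⟨ length-filter≡sum isCounted (words (n + n)) ⟨
    w n k m ∎
    where
    open ≡-Reasoning
    isCounted : List Step → Bool
    isCounted p = isDyck n p ∧ (#UD p ≡ᵇ k) ∧ (#UUD p ≡ᵇ m)
    endsInU : ∀ p → χ (p ∷ʳ U) * firstPassage (p ∷ʳ U) ≡ 0
    endsInU p rewrite isFirstPassage-∷ʳU 0 p = *-zeroʳ (χ (p ∷ʳ U))
    endsInD : ∀ p → χ (p ∷ʳ D) * firstPassage (p ∷ʳ D) ≡ ⟦ isCounted p ⟧
    endsInD p rewrite isDyck≡isFirstPassage-∷ʳD n p with isFirstPassage 0 (p ∷ʳ D) in fp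
    ... | false = *-zeroʳ (χ (p ∷ʳ D))
    ... | true
      rewrite #U-∷ʳD p | #D-∷ʳD p | cyclic#UD-∷ʳD p | cyclic#UUD-∷ʳD p
            | proj₁ (#UD,#UUD-firstPassage p fp) | proj₂ (#UD,#UUD-firstPassage p fp)
            | #D≡#U-firstPassage p fp =
      trans (*-identityʳ _) (cong ⟦_⟧ (∧-dup (#U p ≡ᵇ n) _))

  Σ-χ·startsWithD≡Σ-HasCounts : Σ-words L (λ v → χ v * startsWithD v) ≡ Σ-words (n + n) (⟦_⟧ ∘ HasCounts [] n n k m)
  Σ-χ·startsWithD≡Σ-HasCounts = cong₂ _+_ (trans (Σ-words-cong (n + n) (λ p _ → *-zeroʳ (χ (U ∷ p)))) (Σ-words-0 (n + n)))
                                          (Σ-words-cong (n + n) (λ p _ → startsInD p))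
    where
    startsInD : ∀ p → χ (D ∷ p) * 1 ≡ ⟦ HasCounts [] n n k m p ⟧
    startsInD p rewrite cyclic#UD-D∷ p | cyclic#UUD-D∷ p = *-identityʳ _

  [1+n]*w≡Σ-HasCounts : suc n * w n k m ≡ Σ-words (n + n) (⟦_⟧ ∘ HasCounts [] n n k m)
  [1+n]*w≡Σ-HasCounts = begin
    suc n * w n k m                                 ≡⟨ cong (suc n *_) Σ-χ·firstPassage≡w ⟨
    suc n * Σ-words L (λ v → χ v * firstPassage v)  ≡⟨ doubleCounting ⟩
    Σ-words L (λ v → χ v * startsWithD v)           ≡⟨ Σ-χ·startsWithD≡Σ-HasCounts ⟩
    Σ-words (n + n) (⟦_⟧ ∘ HasCounts [] n n k m)    ∎
    where open ≡-Reasoning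

-- The closed form

binom≡C : ∀ n k → binom n k ≡ n C k
binom≡C n       zero    = refl
binom≡C zero    (suc k) = refl
binom≡C (suc n) (suc k) = trans (cong₂ _+_ (binom≡C n k) (binom≡C n (suc k))) (nCk+nC[k+1]≡[n+1]C[k+1] n k)

binom-> : ∀ {n k} → n < k → binom n k ≡ 0
binom-> {n} {k} n<k = trans (binom≡C n k) (k>n⇒nCk≡0 n<k)

binom-[1+n]n : ∀ n → binom (suc n) n ≡ suc n
binom-[1+n]n n = begin
  binom (suc n) n         ≡⟨ binom≡C (suc n) n ⟩
  suc n C n               ≡⟨ nCk≡nC[n∸k] (n≤1+n n) ⟩
  suc n C (1 + n ∸ n)     ≡⟨ cong (suc n C_) (m+n∸n≡m 1 n) ⟩
  suc n C 1               ≡⟨ nC1≡n (suc n) ⟩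
  suc n                   ∎
  where open ≡-Reasoning

binom-absorb : ∀ n k → suc k * binom (suc n) (suc k) ≡ suc n * binom n k
binom-absorb zero    zero    = refl
binom-absorb zero    (suc k) = *-zeroʳ (suc (suc k))
binom-absorb (suc n) zero    = trans (+-identityʳ _) (trans (cong (2 +_) (trans (binom≡C n 1) (nC1≡n n))) (sym (*-identityʳ (2 + n))))
binom-absorb (suc n) (suc k) = begin
  suc (suc k) * ((c + d) + e)           ≡⟨ expand k c d e ⟩
  (c + d) + suc k * (c + d) + suc (suc k) * e ≡⟨ cong₂ (λ x y → (c + d) + x + y) (binom-absorb n k) (binom-absorb n (suc k)) ⟩
  (c + d) + suc n * c + suc n * d       ≡⟨ collect n c d ⟩
  suc (suc n) * (c + d)                 ∎
  where
  open ≡-Reasoning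
  c = binom n k
  d = binom n (suc k)
  e = binom (suc n) (suc (suc k))
  expand : ∀ k c d e → suc (suc k) * ((c + d) + e) ≡ (c + d) + suc k * (c + d) + suc (suc k) * e
  expand = solve-∀
  collect : ∀ n c d → (c + d) + suc n * c + suc n * d ≡ suc (suc n) * (c + d)
  collect = solve-∀

spread-+ : ∀ k t m → spread (k + t) k m ≡ compositions t m
spread-+ zero    t m = refl
spread-+ (suc k) t m = spread-+ k t m

spread-< : ∀ {a k} m → a < k → spread a k m ≡ 0
spread-< {zero}  {suc k} m _         = refl
spread-< {suc a} {suc k} m (s≤s a<k) = spread-< m a<k

[1+n]*w≡runCount : ∀ n k m → suc n * w n k m ≡ runCount afterD n n k m
[1+n]*w≡runCount n k m =
  trans (CyclicClass.[1+n]*w≡Σ-HasCounts n k m) (Σ-HasCounts≡runCount (n + n) afterD n n k m refl)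

[1+k]*w≡binom*binom*spread : ∀ n k m → suc k * w n (suc k) m ≡ binom n k * (binom (suc k) m * spread n (suc k) m)
[1+k]*w≡binom*binom*spread n k m = *-cancelˡ-≡ _ _ (suc n) (begin
  suc n * (suc k * w n (suc k) m)        ≡⟨ x*[y*z]≡y*[x*z] (suc n) (suc k) _ ⟩
  suc k * (suc n * w n (suc k) m)        ≡⟨ cong (suc k *_) ([1+n]*w≡runCount n (suc k) m) ⟩
  suc k * (binom (suc n) (suc k) * Y)    ≡⟨ *-assoc (suc k) (binom (suc n) (suc k)) Y ⟨
  (suc k * binom (suc n) (suc k)) * Y    ≡⟨ cong (_* Y) (binom-absorb n k) ⟩
  (suc n * binom n k) * Y                ≡⟨ *-assoc (suc n) (binom n k) Y ⟩
  suc n * (binom n k * Y)                ∎)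
  where
  open ≡-Reasoning
  Y = binom (suc k) m * spread n (suc k) m

w≡0 : ∀ n k m → binom k m * spread n k m ≡ 0 → w n k m ≡ 0
w≡0 n k m choices≡0 = *-cancelˡ-≡ _ _ (suc n) (begin
  suc n * w n k m                             ≡⟨ [1+n]*w≡runCount n k m ⟩
  binom (suc n) k * (binom k m * spread n k m) ≡⟨ cong (binom (suc n) k *_) choices≡0 ⟩
  binom (suc n) k * 0                         ≡⟨ *-zeroʳ (binom (suc n) k) ⟩
  0                                           ≡⟨ *-zeroʳ (suc n) ⟨
  suc n * 0                                   ∎)
  where open ≡-Reasoning

w-positive : ∀ n k m → 0 < m → m ≤ k → k + m ≤ n →
  k * w n k m ≡ (n C (k ∸ 1)) * ((n ∸ k ∸ 1) C (m ∸ 1)) * (k C m)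
w-positive n (suc k) (suc m) _ _ k+m≤n with m≤n⇒∃[o]m+o≡n k+m≤n
... | o , refl = begin
  K * w N K M                                   ≡⟨ [1+k]*w≡binom*binom*spread N k M ⟩
  binom N k * (binom K M * spread N K M)        ≡⟨ cong (λ x → binom N k * (binom K M * x)) spread-N ⟩
  binom N k * (binom K M * binom (m + o) m)     ≡⟨ x*[y*z]≡x*z*y (binom N k) (binom K M) _ ⟩
  binom N k * binom (m + o) m * binom K M       ≡⟨ cong₂ _*_ (cong₂ _*_ (binom≡C N k) (binom≡C (m + o) m)) (binom≡C K M) ⟩
  (N C k) * ((m + o) C m) * (K C M)             ≡⟨ cong (λ x → (N C k) * (x C m) * (K C M)) N∸K∸1 ⟨
  (N C k) * ((N ∸ K ∸ 1) C m) * (K C M)         ∎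
  where
  open ≡-Reasoning
  K = suc k
  M = suc m
  N = K + M + o
  x*[y*z]≡x*z*y : ∀ x y z → x * (y * z) ≡ x * z * y
  x*[y*z]≡x*z*y = solve-∀
  spread-N : spread N K M ≡ binom (m + o) m
  spread-N = trans (cong (λ a → spread a K M) (+-assoc K M o)) (spread-+ K (M + o) M)
  N∸K∸1 : N ∸ K ∸ 1 ≡ m + o
  N∸K∸1 = cong (_∸ 1) (trans (cong (_∸ K) (+-assoc K M o)) (m+n∸m≡n K (M + o)))

w-diagonal : ∀ n → w n n 0 ≡ 1
w-diagonal n = *-cancelˡ-≡ _ _ (suc n) (begin
  suc n * w n n 0                                 ≡⟨ [1+n]*w≡runCount n n 0 ⟩
  binom (suc n) n * (1 * spread n n 0)            ≡⟨ cong (λ a → binom (suc n) n * (1 * spread a n 0)) (+-identityʳ n) ⟨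
  binom (suc n) n * (1 * spread (n + 0) n 0)      ≡⟨ cong (λ x → binom (suc n) n * (1 * x)) (spread-+ n 0 0) ⟩
  binom (suc n) n * 1                             ≡⟨ cong (_* 1) (binom-[1+n]n n) ⟩
  suc n * 1                                       ∎)
  where open ≡-Reasoning

compositions-< : ∀ {t m} → t < m → compositions t m ≡ 0
compositions-< {zero}  {suc m} _         = refl
compositions-< {suc t} {suc m} (s≤s t<m) = binom-> t<m

binom*compositions≡0 : ∀ k t m → ¬ ((0 < m) × (m ≤ k) × (k + m ≤ k + t)) → ¬ ((m ≡ 0) × (k + t ≡ k)) →
  binom k m * compositions t m ≡ 0
binom*compositions≡0 k zero    zero    _           notDiagonal = ⊥-elim (notDiagonal (refl , +-identityʳ k))
binom*compositions≡0 k (suc t) zero    _           _           = refl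
binom*compositions≡0 k t       (suc m) notPositive _ with suc m ≤? k | suc m ≤? t
... | no m≰k  | _       = cong (_* compositions t (suc m)) (binom-> (≰⇒> m≰k))
... | yes m≤k | yes m≤t = ⊥-elim (notPositive (s≤s z≤n , m≤k , +-monoʳ-≤ k m≤t))
... | yes _   | no m≰t  = trans (cong (binom k (suc m) *_) (compositions-< (≰⇒> m≰t))) (*-zeroʳ (binom k (suc m)))

binom*spread≡0 : ∀ n k m → ¬ ((0 < m) × (m ≤ k) × (k + m ≤ n)) → ¬ ((m ≡ 0) × (n ≡ k)) →
  binom k m * spread n k m ≡ 0
binom*spread≡0 n k m notPositive notDiagonal with k ≤? n
... | no k≰n = trans (cong (binom k m *_) (spread-< m (≰⇒> k≰n))) (*-zeroʳ (binom k m))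
... | yes k≤n with m≤n⇒∃[o]m+o≡n k≤n
...   | t , refl = trans (cong (binom k m *_) (spread-+ k t m)) (binom*compositions≡0 k t m notPositive notDiagonal)

theorem1p2 : (n k m : ℕ) →
    ((0 < m) × (m ≤ k) × (k + m ≤ n) →
      k * w n k m ≡ (n C (k ∸ 1)) * ((n ∸ k ∸ 1) C (m ∸ 1)) * (k C m))
    × ((m ≡ 0) × (n ≡ k) → w n k m ≡ 1)
    × (¬ ((0 < m) × (m ≤ k) × (k + m ≤ n)) → ¬ ((m ≡ 0) × (n ≡ k)) → w n k m ≡ 0)
theorem1p2 n k m =
    (λ (0<m , m≤k , k+m≤n) → w-positive n k m 0<m m≤k k+m≤n)
  , (λ { (refl , refl) → w-diagonal n })
  , (λ notPositive notDiagonal → w≡0 n k m (binom*spread≡0 n k m notPositive notDiagonal))
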